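{- Let $r\geq 2$. Let $\mathcal{G}^{(r)}$ be the edge-labelled path on the $2r$ vertices $a_r,a_{r-1},\dots,a_1,b_1,b_2,\dots,b_r$ with an edge $\{a_1,b_1\}$ of label $0$ and, for each $j=1,\dots,r-1$, edges $\{a_j,a_{j+1}\}$ and $\{b_j,b_{j+1}\}$ of label $j$. Then $\mathcal{G}^{(r)}$ is a CPR graph and the group it represents is isomorphic to the wreath product $C_2\wr S_r$.
   Context: A string C-group of rank $r$ is a group $G$ with an ordered sequence $(\rho_0,\dots,\rho_{r-1})$ of involutions generating $G$ such that $(\rho_i\rho_j)^2=1$ whenever $|i-j|\geq2$ and $\langle \rho_i : i\in I\rangle\cap\langle\rho_j : j\in J\rangle=\langle \rho_k : k\in I\cap J\rangle$ for all $I,J\subseteq\{0,\dots,r-1\}$. An edge-labelled multigraph on a finite set $\Omega$ with labels $0,\dots,r-1$, in which each vertex lies on at most one edge of each label and each label occurs, determines involutions $\rho_l\in\mathrm{Sym}(\Omega)$, $\rho_l$ being the product of the transpositions $(a\,b)$ over the edges $\{a,b\}$ of label $l$; the group it represents is $\langle\rho_0,\dots,\rho_{r-1}\rangle$, and the graph is a CPR graph if this group with generating sequence $(\rho_0,\dots,\rho_{r-1})$ is a string C-group. -}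

module Defs where

open import Data.Nat using (ℕ; zero; suc; _+_; _≤_)
open import Data.Bool using (Bool; _xor_)
open import Data.Fin using (Fin; toℕ; _↑ˡ_; _↑ʳ_; inject₁; _≟_)
  renaming (zero to fzero; suc to fsuc)
open import Data.Fin.Subset using (Subset; _∈_; _∩_; ⊤)
open import Data.Fin.Permutation using (Permutation′; _⟨$⟩ʳ_; _⟨$⟩ˡ_; _∘ₚ_)
open import Data.List using (List; []; _∷_; _++_; length; concatMap; lookup)
open import Data.List.Relation.Unary.All using (All)
open import Data.List.Relation.Unary.Any using (Any)
open import Data.Product using (Σ; _×_; _,_; ∃; proj₁)
open import Data.Sum using (_⊎_)
open import Data.Vec using (allFin)
import Data.Vec as Vec
open import Function using (_∘_; id)
open import Relation.Binary.PropositionalEquality using (_≡_; _≢_; _≗_)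
open import Relation.Nullary using (¬_; yes; no)

-- Elements of Sym(Ω), Ω = Fin n, represented as functions Fin n → Fin n,
-- compared pointwise (_≗_). Product g·h = g ∘ h (apply h first).

evalWord : ∀ {r n} → (Fin r → Fin n → Fin n) → List (Fin r) → Fin n → Fin n
evalWord ρ []       = id
evalWord ρ (i ∷ w)  = ρ i ∘ evalWord ρ w

-- g lies in ⟨ ρ_i : i ∈ I ⟩.  Since the ρ_i are involutions, every element
-- of the generated subgroup is a product of generators (no inverses needed);
-- the empty word gives the identity.
_∈⟨_⟩[_] : ∀ {r n} → (Fin n → Fin n) → Subset r → (Fin r → Fin n → Fin n) → Set
g ∈⟨ I ⟩[ ρ ] = Σ (List _) λ w → All (_∈ I) w × (evalWord ρ w ≗ g)

FarApart : ∀ {r} → Fin r → Fin r → Set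
FarApart i j = (2 + toℕ i ≤ toℕ j) ⊎ (2 + toℕ j ≤ toℕ i)

record IsStringCGroup {r n : ℕ} (ρ : Fin r → Fin n → Fin n) : Set where
  field
    involution    : ∀ i → ρ i ∘ ρ i ≗ id
    nontrivial    : ∀ i → ¬ (ρ i ≗ id)
    stringCommute : ∀ i j → FarApart i j → (ρ i ∘ ρ j) ∘ (ρ i ∘ ρ j) ≗ id
    intersection  : ∀ (I J : Subset r) (g : Fin n → Fin n) →
                    ((g ∈⟨ I ⟩[ ρ ] × g ∈⟨ J ⟩[ ρ ]) → g ∈⟨ I ∩ J ⟩[ ρ ])
                    × (g ∈⟨ I ∩ J ⟩[ ρ ] → (g ∈⟨ I ⟩[ ρ ] × g ∈⟨ J ⟩[ ρ ]))

Edge : ℕ → ℕ → Set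
Edge r n = Fin r × Fin n × Fin n

label : ∀ {r n} → Edge r n → Fin r
label (l , _ , _) = l

OnEdge : ∀ {r n} → Fin n → Edge r n → Set
OnEdge x (_ , u , v) = (x ≡ u) ⊎ (x ≡ v)

record IsLabelledGraph {r n : ℕ} (E : List (Edge r n)) : Set where
  field
    noLoops      : All (λ { (_ , u , v) → u ≢ v }) E
    atMostOne    : ∀ (p q : Fin (length E)) → p ≢ q →
                   label (lookup E p) ≡ label (lookup E q) →
                   ∀ x → OnEdge x (lookup E p) → ¬ OnEdge x (lookup E q)
    labelsOccur  : ∀ l → Any (λ e → label e ≡ l) E

-- ρ_l : the product of the transpositions (u v) over the edges {u,v} of
-- label l (for a well-formed graph: swap x with its l-neighbour, if any).
ρ : ∀ {r n} → List (Edge r n) → Fin r → Fin n → Fin n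
ρ [] l x = x
ρ ((l' , u , v) ∷ E) l x with l' ≟ l | x ≟ u | x ≟ v
... | yes _ | yes _ | _     = v
... | yes _ | no _  | yes _ = u
... | _     | _     | _     = ρ E l x

IsCPRGraph : ∀ {r n} → List (Edge r n) → Set
IsCPRGraph E = IsLabelledGraph E × IsStringCGroup (ρ E)

-- The graph 𝒢^(r) on 2r vertices (Fin (r + r)).
-- Using 0-based indices k : Fin r,  a_{k+1} = k ↑ˡ r, b_{k+1} = r ↑ʳ k.

vA : ∀ {r} → Fin r → Fin (r + r)
vA {r} k = k ↑ˡ r

vB : ∀ {r} → Fin r → Fin (r + r)
vB {r} k = r ↑ʳ k

edgesOfLabel : ∀ {m} → Fin (suc m) → List (Edge (suc m) (suc m + suc m))
edgesOfLabel fzero     = (fzero , vA fzero , vB fzero) ∷ []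
edgesOfLabel (fsuc k)  = (fsuc k , vA (inject₁ k) , vA (fsuc k))
                       ∷ (fsuc k , vB (inject₁ k) , vB (fsuc k)) ∷ []

pathGraph : (r : ℕ) → List (Edge r (r + r))
pathGraph zero    = []
pathGraph (suc m) = concatMap edgesOfLabel (Vec.toList (allFin (suc m)))

-- The wreath product C₂ ≀ S_r = C₂^r ⋊ S_r.
-- Elements (v , σ) with v : Fin r → Bool (C₂ = Bool under xor), σ ∈ S_r.
-- (v , σ)(w , τ) = (v + σ·w , στ), (σ·w)(i) = w(σ⁻¹ i), στ = "τ then σ".

Wreath : ℕ → Set
Wreath r = (Fin r → Bool) × Permutation′ r

_≈W_ : ∀ {r} → Wreath r → Wreath r → Set
(v , σ) ≈W (w , τ) = (v ≗ w) × (∀ i → σ ⟨$⟩ʳ i ≡ τ ⟨$⟩ʳ i)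

_·W_ : ∀ {r} → Wreath r → Wreath r → Wreath r
(v , σ) ·W (w , τ) = (λ i → v i xor w (σ ⟨$⟩ˡ i)) , (τ ∘ₚ σ)

record WreathIso {r n : ℕ} (ρ : Fin r → Fin n → Fin n) : Set where
  field
    φ          : Wreath r → Fin n → Fin n
    wellDef    : ∀ x y → x ≈W y → φ x ≗ φ y
    hom        : ∀ x y → φ (x ·W y) ≗ φ x ∘ φ y
    injective  : ∀ x y → φ x ≗ φ y → x ≈W y
    intoG      : ∀ x → φ x ∈⟨ ⊤ ⟩[ ρ ]
    ontoG      : ∀ g → g ∈⟨ ⊤ ⟩[ ρ ] → Σ (Wreath r) λ x → φ x ≗ g

-- The vertices a_{k+1} and b_{k+1} are modelled as the signed positions (false , k) and (true , k):
-- ρ_0 changes the sign at position 0 and ρ_j swaps positions j - 1 and j, so ⟨ρ_0, …, ρ_{r-1}⟩ acts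
-- by signed permutations, and (v , σ) ∈ C₂ ≀ S_r acts faithfully by (s , k) ↦ (s xor v (σ k) , σ k).
-- The heart of the proof describes every parabolic subgroup: ⟨ρ_i : i ∈ I⟩ consists exactly of the
-- signed permutations g that, for each cut l ∉ I, keep positions ≥ l at positions ≥ l and on the
-- same side. Each ρ_i with i ≠ l respects the cut l; conversely such a g is undone position by
-- position from the top, and the generators needed to carry g (false , M) back to (false , M)
-- are ρ_i with i ∈ I, because crossing a cut l ∉ I would contradict the cut condition of g.
-- This description is closed under intersection (l ∉ I ∩ J means l ∉ I or l ∉ J), which gives
-- the intersection property, and for I = ⊤ it shows that the group is all of C₂ ≀ S_r.

module Submission where

open import Data.Nat as ℕ using (ℕ; zero; suc; _+_; _≤_; z≤n; s≤s)
import Data.Nat.Properties as ℕ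
open import Data.Bool using (Bool; true; false; not; _xor_)
open import Data.Bool.Properties using (not-involutive; xor-assoc; xor-comm; xor-identityʳ; not-distribˡ-xor)
open import Data.Fin as Fin using (Fin; zero; suc; toℕ; inject₁; fromℕ<; _≟_; join; splitAt)
import Data.Fin.Properties as Fin
open import Data.Fin.Properties using
  (toℕ-inject₁; toℕ<n; toℕ-fromℕ<; <⇒≢; ≤∧≢⇒<; <⇒≤pred; ≤̄⇒inject₁<; suc-injective; splitAt-join; join-splitAt)
open import Data.Fin.Induction using (<-weakInduction)
open import Data.Fin.Permutation using (Permutation′; _⟨$⟩ʳ_; _⟨$⟩ˡ_; inverseˡ; inverseʳ; permutation)
import Data.Fin.Permutation as Perm
open import Data.Fin.Subset using (Subset; _∈_; _∉_; _∩_; _⊆_)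
open import Data.Fin.Subset.Properties using (_∈?_; x∈p∩q⁺; p∩q⊆p; p∩q⊆q; ∈⊤)
open import Data.List using (List; []; _∷_; _++_; [_]; reverse; filter; concat; concatMap; tabulate; lookup)
open import Data.List.Properties
  using (unfold-reverse; ++-identityʳ; filter-++; filter-all; filter-none; filter-accept; filter-reject)
open import Data.List.Membership.Propositional.Properties using (∈-lookup)
open import Data.List.Relation.Unary.All as All using (All; []; _∷_)
import Data.List.Relation.Unary.All.Properties as All
open import Data.List.Relation.Unary.Any using (Any; here)
import Data.List.Relation.Unary.Any.Properties as Any
open import Data.List.Relation.Unary.AllPairs using (AllPairs; []; _∷_)
import Data.List.Relation.Unary.AllPairs.Properties as AllPairs
open import Data.List.Relation.Binary.Permutation.Propositional using (↭-sym)
open import Data.List.Relation.Binary.Permutation.Propositional.Properties using (All-resp-↭; ↭-reverse)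
import Data.Vec as Vec
open import Data.Product using (Σ; ∃; _×_; _,_; proj₁; proj₂)
open import Data.Sum using (inj₁; inj₂; [_,_]′)
open import Data.Empty using (⊥-elim)
open import Function using (_∘_; id; const; case_of_)
open import Function.Definitions using (Injective)
open import Relation.Binary.Core using (Rel)
open import Relation.Binary.Definitions using (Symmetric)
open import Relation.Binary.PropositionalEquality
  using (_≡_; _≢_; _≗_; refl; sym; trans; cong; cong₂; subst; module ≡-Reasoning)
open import Relation.Nullary using (¬_; Dec; yes; no; contradiction)
open import Relation.Nullary.Decidable using (decidable-stable)
open import Relation.Unary using (Pred; Decidable)

open import Defs

inject₁≢suc : ∀ {m} (q : Fin m) → inject₁ q ≢ suc q
inject₁≢suc q = <⇒≢ (≤̄⇒inject₁< Fin.≤-refl)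

swapAdjacent : ∀ {m} → Fin m → Fin (suc m) → Fin (suc m)
swapAdjacent zero    zero          = suc zero
swapAdjacent zero    (suc zero)    = zero
swapAdjacent zero    (suc (suc k)) = suc (suc k)
swapAdjacent (suc q) zero          = zero
swapAdjacent (suc q) (suc k)       = suc (swapAdjacent q k)

swapAdjacent-involutive : ∀ {m} (q : Fin m) k → swapAdjacent q (swapAdjacent q k) ≡ k
swapAdjacent-involutive zero    zero          = refl
swapAdjacent-involutive zero    (suc zero)    = refl
swapAdjacent-involutive zero    (suc (suc k)) = refl
swapAdjacent-involutive (suc q) zero          = refl
swapAdjacent-involutive (suc q) (suc k)       = cong suc (swapAdjacent-involutive q k)

swapAdjacent-inject₁ : ∀ {m} (q : Fin m) → swapAdjacent q (inject₁ q) ≡ suc q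
swapAdjacent-inject₁ zero    = refl
swapAdjacent-inject₁ (suc q) = cong suc (swapAdjacent-inject₁ q)

swapAdjacent-suc : ∀ {m} (q : Fin m) → swapAdjacent q (suc q) ≡ inject₁ q
swapAdjacent-suc q = begin
  swapAdjacent q (suc q)                          ≡⟨ cong (swapAdjacent q) (swapAdjacent-inject₁ q) ⟨
  swapAdjacent q (swapAdjacent q (inject₁ q))     ≡⟨ swapAdjacent-involutive q (inject₁ q) ⟩
  inject₁ q                                       ∎
  where open ≡-Reasoning

swapAdjacent-fixes-above : ∀ {m} (q : Fin m) {k} → suc q Fin.< k → swapAdjacent q k ≡ k
swapAdjacent-fixes-above zero    {suc zero}    (s≤s ())
swapAdjacent-fixes-above zero    {suc (suc k)} _             = refl
swapAdjacent-fixes-above (suc q) {suc k}       (s≤s q+1<k) = cong suc (swapAdjacent-fixes-above q q+1<k)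

swapAdjacent-fixes-other : ∀ {m} (q : Fin m) {k} → k ≢ inject₁ q → k ≢ suc q → swapAdjacent q k ≡ k
swapAdjacent-fixes-other zero    {zero}        k≢q _     = contradiction refl k≢q
swapAdjacent-fixes-other zero    {suc zero}    _   k≢1+q = contradiction refl k≢1+q
swapAdjacent-fixes-other zero    {suc (suc k)} _   _     = refl
swapAdjacent-fixes-other (suc q) {zero}        _   _     = refl
swapAdjacent-fixes-other (suc q) {suc k}       k≢q k≢1+q =
  cong suc (swapAdjacent-fixes-other q (k≢q ∘ cong suc) (k≢1+q ∘ cong suc))

swapAdjacent-preserves-≥ : ∀ {m} (q : Fin m) {l k} → l ≢ suc q → l Fin.≤ k → l Fin.≤ swapAdjacent q k
swapAdjacent-preserves-≥ q       {zero}                      _   _          = z≤n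
swapAdjacent-preserves-≥ zero    {suc zero}                  l≢1 _          = contradiction refl l≢1
swapAdjacent-preserves-≥ zero    {suc (suc l)} {suc zero}    _   (s≤s ())
swapAdjacent-preserves-≥ zero    {suc (suc l)} {suc (suc k)} _   l≤k        = l≤k
swapAdjacent-preserves-≥ (suc q) {suc l}       {suc k}       l≢q (s≤s l≤k) =
  s≤s (swapAdjacent-preserves-≥ q (l≢q ∘ cong suc) l≤k)

swapAdjacent-comm : ∀ {m} (q q′ : Fin m) → 2 + toℕ q ≤ toℕ q′ →
                    ∀ k → swapAdjacent q (swapAdjacent q′ k) ≡ swapAdjacent q′ (swapAdjacent q k)
swapAdjacent-comm zero    (suc zero)     (s≤s ())
swapAdjacent-comm zero    (suc (suc q′)) _        zero          = refl
swapAdjacent-comm zero    (suc (suc q′)) _        (suc zero)    = refl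
swapAdjacent-comm zero    (suc (suc q′)) _        (suc (suc k)) = refl
swapAdjacent-comm (suc q) (suc q′)       _        zero          = refl
swapAdjacent-comm (suc q) (suc q′)       (s≤s le) (suc k)       = cong suc (swapAdjacent-comm q q′ le k)

Signed : ℕ → Set
Signed r = Bool × Fin r

side : ∀ {r} → Signed r → Bool
side = proj₁

position : ∀ {r} → Signed r → Fin r
position = proj₂

flip : ∀ {r} → Signed r → Signed r
flip (s , k) = (not s , k)

gen : ∀ {r} → Fin r → Signed r → Signed r
gen zero    (s , zero)  = (not s , zero)
gen zero    (s , suc k) = (s , suc k)
gen (suc q) (s , k)     = (s , swapAdjacent q k)

module _ {r : ℕ} where

  gen-involutive : ∀ (l : Fin r) z → gen l (gen l z) ≡ z
  gen-involutive zero    (s , zero)  = cong (_, zero) (not-involutive s)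
  gen-involutive zero    (s , suc k) = refl
  gen-involutive (suc q) (s , k)     = cong (s ,_) (swapAdjacent-involutive q k)

  gen-flip : ∀ (l : Fin r) z → gen l (flip z) ≡ flip (gen l z)
  gen-flip zero    (s , zero)  = refl
  gen-flip zero    (s , suc k) = refl
  gen-flip (suc q) (s , k)     = refl

  gen-moves : ∀ (l : Fin r) → ∃ λ z → gen l z ≢ z
  gen-moves zero    = (false , zero) , λ ()
  gen-moves (suc q) = (false , inject₁ q) , λ e →
    inject₁≢suc q (trans (sym (cong position e)) (swapAdjacent-inject₁ q))

  gen-fixes-above : ∀ (l : Fin r) {z} → l Fin.< position z → gen l z ≡ z
  gen-fixes-above zero    {s , suc k} _   = refl
  gen-fixes-above (suc q) {s , k}     l<k = cong (s ,_) (swapAdjacent-fixes-above q l<k)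

  gen-comm : ∀ (i j : Fin r) → 2 + toℕ i ≤ toℕ j → ∀ z → gen i (gen j z) ≡ gen j (gen i z)
  gen-comm zero    (suc zero)    (s≤s ())
  gen-comm zero    (suc (suc q)) _        (s , zero)  = refl
  gen-comm zero    (suc (suc q)) _        (s , suc k) = refl
  gen-comm (suc q) (suc q′)      (s≤s le) (s , k)     = cong (s ,_) (swapAdjacent-comm q q′ le k)

  gen-farApart-squared : ∀ (i j : Fin r) → FarApart i j → ∀ z → gen i (gen j (gen i (gen j z))) ≡ z
  gen-farApart-squared i j far z = begin
    gen i (gen j (gen i (gen j z))) ≡⟨ cong (gen i) (commute far (gen j z)) ⟩
    gen i (gen i (gen j (gen j z))) ≡⟨ gen-involutive i _ ⟩
    gen j (gen j z)                 ≡⟨ gen-involutive j z ⟩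
    z                               ∎
    where
      open ≡-Reasoning
      commute : FarApart i j → ∀ z → gen j (gen i z) ≡ gen i (gen j z)
      commute (inj₁ i≪j) = sym ∘ gen-comm i j i≪j
      commute (inj₂ j≪i) = gen-comm j i j≪i

  eval : List (Fin r) → Signed r → Signed r
  eval []      = id
  eval (l ∷ w) = gen l ∘ eval w

  eval-++ : ∀ u w z → eval (u ++ w) z ≡ eval u (eval w z)
  eval-++ []      w z = refl
  eval-++ (l ∷ u) w z = cong (gen l) (eval-++ u w z)

  eval-reverse : ∀ w z → eval (reverse w) (eval w z) ≡ z
  eval-reverse []      z = refl
  eval-reverse (l ∷ w) z = begin
    eval (reverse (l ∷ w)) (gen l (eval w z))      ≡⟨ cong (λ u → eval u (gen l (eval w z))) (unfold-reverse l w) ⟩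
    eval (reverse w ++ [ l ]) (gen l (eval w z))   ≡⟨ eval-++ (reverse w) [ l ] _ ⟩
    eval (reverse w) (gen l (gen l (eval w z)))    ≡⟨ cong (eval (reverse w)) (gen-involutive l _) ⟩
    eval (reverse w) (eval w z)                    ≡⟨ eval-reverse w z ⟩
    z                                              ∎
    where open ≡-Reasoning

  eval-fixes-above : ∀ {w z} → All (Fin._< position z) w → eval w z ≡ z
  eval-fixes-above {[]}    []          = refl
  eval-fixes-above {l ∷ w} (l<z ∷ w<z) = trans (cong (gen l) (eval-fixes-above w<z)) (gen-fixes-above l l<z)

  infix 4 _∈⟪_⟫
  _∈⟪_⟫ : (Signed r → Signed r) → Subset r → Set
  g ∈⟪ I ⟫ = Σ (List (Fin r)) λ w → All (_∈ I) w × eval w ≗ g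

  All-reverse⁺ : ∀ {p} {P : Pred (Fin r) p} {w} → All P w → All P (reverse w)
  All-reverse⁺ {w = w} = All-resp-↭ (↭-sym (↭-reverse w))

  ∈⟪⟫-cancelˡ : ∀ {I g w} → All (_∈ I) w → eval w ∘ g ∈⟪ I ⟫ → g ∈⟪ I ⟫
  ∈⟪⟫-cancelˡ {w = w} w∈I (u , u∈I , u≗wg) =
    reverse w ++ u , All.++⁺ (All-reverse⁺ w∈I) u∈I ,
    λ z → trans (eval-++ (reverse w) u z) (trans (cong (eval (reverse w)) (u≗wg z)) (eval-reverse w _))

  Reachable : ∀ {p} → Pred (Fin r) p → Signed r → Signed r → Set p
  Reachable Q z z′ = Σ (List (Fin r)) λ w → All Q w × eval w z ≡ z′

  module _ {p} {Q : Pred (Fin r) p} where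

    reachable-refl : ∀ {z} → Reachable Q z z
    reachable-refl = [] , [] , refl

    reachable-step : ∀ {l} z → Q l → Reachable Q z (gen l z)
    reachable-step {l} z ql = [ l ] , ql ∷ [] , refl

    reachable-trans : ∀ {z z′ z″} → Reachable Q z z′ → Reachable Q z′ z″ → Reachable Q z z″
    reachable-trans (w , qw , wz≡z′) (u , qu , uz′≡z″) =
      u ++ w , All.++⁺ qu qw , trans (eval-++ u w _) (trans (cong (eval u) wz≡z′) uz′≡z″)

    reachable-sym : ∀ {z z′} → Reachable Q z z′ → Reachable Q z′ z
    reachable-sym {z} (w , qw , refl) = reverse w , All-reverse⁺ qw , eval-reverse w z

module _ {n : ℕ} {p} {Q : Pred (Fin (suc n)) p} where

  climb : ∀ s {i j : Fin (suc n)} → i Fin.≤ j → (∀ {l} → i Fin.< l → l Fin.≤ j → Q l) → Reachable Q (s , i) (s , j)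
  climb s {i} {j} = <-weakInduction ClimbsTo base step j
    where
      ClimbsTo : Fin (suc n) → Set p
      ClimbsTo j = i Fin.≤ j → (∀ {l} → i Fin.< l → l Fin.≤ j → Q l) → Reachable Q (s , i) (s , j)

      base : ClimbsTo zero
      base i≤0 _ = subst (λ j → Reachable Q (s , i) (s , j)) (Fin.≤-antisym i≤0 z≤n) reachable-refl

      step : ∀ j → ClimbsTo (inject₁ j) → ClimbsTo (suc j)
      step j ih i≤j+1 Q⟨i,j+1] with i ≟ suc j
      ... | yes refl  = reachable-refl
      ... | no  i≢j+1 = reachable-trans (ih (<⇒≤pred i<j+1) Q⟨i,j]) last-step
        where
          i<j+1 : i Fin.< suc j
          i<j+1 = ≤∧≢⇒< i≤j+1 i≢j+1
          Q⟨i,j] : ∀ {l} → i Fin.< l → l Fin.≤ inject₁ j → Q l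
          Q⟨i,j] i<l l≤j = Q⟨i,j+1] i<l (ℕ.m≤n⇒m≤1+n (subst (_ ≤_) (toℕ-inject₁ j) l≤j))
          last-step : Reachable Q (s , inject₁ j) (s , suc j)
          last-step = subst (Reachable Q (s , inject₁ j)) (cong (s ,_) (swapAdjacent-inject₁ j))
                            (reachable-step (s , inject₁ j) (Q⟨i,j+1] i<j+1 Fin.≤-refl))

module _ {r : ℕ} where

  record IsSigned (g : Signed r → Signed r) : Set where
    field
      flip-commute : ∀ z → g (flip z) ≡ flip (g z)
      injective    : Injective _≡_ _≡_ g

  open IsSigned

  isSigned-∘ : ∀ {f g} → IsSigned f → IsSigned g → IsSigned (f ∘ g)
  isSigned-∘ {f} {g} sf sg = record
    { flip-commute = λ z → trans (cong f (flip-commute sg z)) (flip-commute sf (g z))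
    ; injective    = injective sg ∘ injective sf
    }

  isSigned-resp-≗ : ∀ {f g} → f ≗ g → IsSigned f → IsSigned g
  isSigned-resp-≗ f≗g sf = record
    { flip-commute = λ z → trans (sym (f≗g (flip z))) (trans (flip-commute sf z) (cong flip (f≗g z)))
    ; injective    = λ {z} {z′} gz≡gz′ → injective sf (trans (f≗g z) (trans gz≡gz′ (sym (f≗g z′))))
    }

  gen-isSigned : ∀ l → IsSigned (gen l)
  gen-isSigned l = record
    { flip-commute = gen-flip l
    ; injective    = λ {z} {z′} e → trans (sym (gen-involutive l z)) (trans (cong (gen l) e) (gen-involutive l z′))
    }

  eval-isSigned : ∀ w → IsSigned (eval w)
  eval-isSigned []      = record { flip-commute = λ _ → refl ; injective = id }
  eval-isSigned (l ∷ w) = isSigned-∘ (gen-isSigned l) (eval-isSigned w)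

  ∈⟪⟫⇒isSigned : ∀ {I g} → g ∈⟪ I ⟫ → IsSigned g
  ∈⟪⟫⇒isSigned (w , _ , w≗g) = isSigned-resp-≗ w≗g (eval-isSigned w)

  RespectsCut : Fin r → (Signed r → Signed r) → Set
  RespectsCut l g = ∀ {z} → l Fin.≤ position z → l Fin.≤ position (g z) × side (g z) ≡ side z

  RespectsCutsOutside : Subset r → (Signed r → Signed r) → Set
  RespectsCutsOutside I g = ∀ {l} → l ∉ I → RespectsCut l g

  respectsCut-∘ : ∀ {l f g} → RespectsCut l f → RespectsCut l g → RespectsCut l (f ∘ g)
  respectsCut-∘ cut-f cut-g l≤z =
    let l≤gz  , sameSide  = cut-g l≤z
        l≤fgz , sameSide′ = cut-f l≤gz
    in l≤fgz , trans sameSide′ sameSide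

  gen-respectsCut : ∀ {i l} → i ≢ l → RespectsCut l (gen i)
  gen-respectsCut {zero}  {zero}  0≢0 _                 = contradiction refl 0≢0
  gen-respectsCut {zero}  {suc l} _   {s , suc k} l≤k   = l≤k , refl
  gen-respectsCut {suc q} {l}     q≢l {s , k}     l≤k   = swapAdjacent-preserves-≥ q (q≢l ∘ sym) l≤k , refl

  eval-respectsCut : ∀ {l w} → All (_≢ l) w → RespectsCut l (eval w)
  eval-respectsCut []          l≤z = l≤z , refl
  eval-respectsCut (i≢l ∷ w≢l) = respectsCut-∘ (gen-respectsCut i≢l) (eval-respectsCut w≢l)

  ∈⟪⟫⇒respectsCutsOutside : ∀ {I g} → g ∈⟪ I ⟫ → RespectsCutsOutside I g
  ∈⟪⟫⇒respectsCutsOutside {I} (w , w∈I , w≗g) {l} l∉I {z} l≤z rewrite sym (w≗g z) =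
    eval-respectsCut (All.map (λ i∈I i≡l → l∉I (subst (_∈ I) i≡l i∈I)) w∈I) l≤z

module _ {n : ℕ} {I : Subset (suc n)} where

  open IsSigned

  FixesFrom : ℕ → (Signed (suc n) → Signed (suc n)) → Set
  FixesFrom m g = ∀ z → m ≤ toℕ (position z) → g z ≡ z

  fixesFrom-beyond : ∀ {m g} → suc n ≤ m → FixesFrom m g
  fixesFrom-beyond r≤m z m≤z = ⊥-elim (ℕ.<⇒≱ (toℕ<n (position z)) (ℕ.≤-trans r≤m m≤z))

  image-position-≤ : ∀ {g} M → IsSigned g → FixesFrom (suc (toℕ M)) g → position (g (false , M)) Fin.≤ M
  image-position-≤ {g} M sg fix with position (g (false , M)) Fin.≤? M
  ... | yes p≤M = p≤M
  ... | no  p≰M = contradiction (Fin.≤-reflexive (cong position (injective sg (fix _ (ℕ.≰⇒> p≰M))))) p≰M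

  label-in-I-above-image : ∀ {g l p} M → RespectsCutsOutside I g → g (false , M) ≡ (false , p) →
                           p Fin.< l → l Fin.≤ M → l ∈ I
  label-in-I-above-image M cuts gM≡ p<l l≤M = decidable-stable (_ ∈? I) λ l∉I →
    ℕ.<⇒≱ p<l (subst (λ v → _ Fin.≤ position v) gM≡ (proj₁ (cuts l∉I l≤M)))

  label-in-I-below-flipped-image : ∀ {g l p} M → RespectsCutsOutside I g → g (false , M) ≡ (true , p) →
                                   l Fin.≤ M → l ∈ I
  label-in-I-below-flipped-image M cuts gM≡ l≤M = decidable-stable (_ ∈? I) λ l∉I →
    case trans (cong side (sym gM≡)) (proj₂ (cuts l∉I l≤M)) of λ ()

  returnPath : ∀ {g} (M : Fin (suc n)) → IsSigned g → RespectsCutsOutside I g → FixesFrom (suc (toℕ M)) g →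
               Reachable (λ l → l ∈ I × l Fin.≤ M) (g (false , M)) (false , M)
  returnPath {g} M sg cuts fix with g (false , M) in gM≡v | image-position-≤ M sg fix
  ... | false , p | p≤M = climb false p≤M λ p<l l≤M → label-in-I-above-image M cuts gM≡v p<l l≤M , l≤M
  ... | true  , p | p≤M =
    reachable-trans (reachable-sym (climb true z≤n λ _ l≤p → below-M (Fin.≤-trans l≤p p≤M)))
      (reachable-trans (reachable-step (true , zero) (below-M z≤n)) (climb false z≤n λ _ → below-M))
    where
      below-M : ∀ {l} → l Fin.≤ M → l ∈ I × l Fin.≤ M
      below-M l≤M = label-in-I-below-flipped-image M cuts gM≡v l≤M , l≤M

  fixesFrom-after-return : ∀ {g w} (M : Fin (suc n)) → IsSigned g → FixesFrom (suc (toℕ M)) g →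
                           All (Fin._≤ M) w →
                           eval w (g (false , M)) ≡ (false , M) → FixesFrom (toℕ M) (eval w ∘ g)
  fixesFrom-after-return {g} {w} M sg fix w≤M returned (s , k) M≤k with k ≟ M
  ... | no k≢M = trans (cong (eval w) (fix _ M<k)) (eval-fixes-above (All.map (λ l≤M → ℕ.≤-<-trans l≤M M<k) w≤M))
    where
      M<k : M Fin.< k
      M<k = ≤∧≢⇒< M≤k (k≢M ∘ sym)
  fixesFrom-after-return {g} {w} M sg fix w≤M returned (false , k) M≤k | yes refl = returned
  fixesFrom-after-return {g} {w} M sg fix w≤M returned (true  , k) M≤k | yes refl =
    trans (flip-commute (isSigned-∘ (eval-isSigned w) sg) (false , M)) (cong flip returned)

  fixNextPosition : ∀ {m g} → m ℕ.< suc n → IsSigned g → RespectsCutsOutside I g → FixesFrom (suc m) g →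
                    Σ (List (Fin (suc n))) λ w → All (_∈ I) w × FixesFrom m (eval w ∘ g)
  fixNextPosition {m} {g} m<r sg cuts fix =
    let w , w∈I×≤M , returned = returnPath M sg cuts fixM
    in w , All.map proj₁ w∈I×≤M ,
       subst (λ k → FixesFrom k (eval w ∘ g)) M≡m
             (fixesFrom-after-return M sg fixM (All.map proj₂ w∈I×≤M) returned)
    where
      M = fromℕ< m<r
      M≡m : toℕ M ≡ m
      M≡m = toℕ-fromℕ< m<r
      fixM : FixesFrom (suc (toℕ M)) g
      fixM = subst (λ k → FixesFrom (suc k) g) (sym M≡m) fix

  generateFrom : ∀ m {g} → FixesFrom m g → IsSigned g → RespectsCutsOutside I g → g ∈⟪ I ⟫
  generateFrom zero    fix _ _ = [] , [] , λ z → sym (fix z z≤n)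
  generateFrom (suc m) {g} fix sg cuts with m ℕ.<? suc n
  ... | no  m≮r = generateFrom m (fixesFrom-beyond (ℕ.≮⇒≥ m≮r)) sg cuts
  ... | yes m<r =
    let w , w∈I , fix′ = fixNextPosition m<r sg cuts fix
        w-cuts = ∈⟪⟫⇒respectsCutsOutside (w , w∈I , λ _ → refl)
    in ∈⟪⟫-cancelˡ w∈I (generateFrom m fix′ (isSigned-∘ (eval-isSigned w) sg)
                                           (λ l∉I → respectsCut-∘ (w-cuts l∉I) (cuts l∉I)))

  generate : ∀ {g} → IsSigned g → RespectsCutsOutside I g → g ∈⟪ I ⟫
  generate = generateFrom (suc n) (fixesFrom-beyond ℕ.≤-refl)

∈⟪⟫-∩ : ∀ {n} {I J : Subset (suc n)} {g} → g ∈⟪ I ⟫ → g ∈⟪ J ⟫ → g ∈⟪ I ∩ J ⟫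
∈⟪⟫-∩ {I = I} {J} g∈I g∈J = generate (∈⟪⟫⇒isSigned g∈I) cuts
  where
    cuts : RespectsCutsOutside (I ∩ J) _
    cuts {l} l∉I∩J with l ∈? I
    ... | no  l∉I = ∈⟪⟫⇒respectsCutsOutside g∈I l∉I
    ... | yes l∈I = ∈⟪⟫⇒respectsCutsOutside g∈J (λ l∈J → l∉I∩J (x∈p∩q⁺ (l∈I , l∈J)))

xor-cancelʳ : ∀ a b c → a xor c ≡ b xor c → a ≡ b
xor-cancelʳ a     b     false e = trans (sym (xor-identityʳ a)) (trans e (xor-identityʳ b))
xor-cancelʳ true  true  true  _ = refl
xor-cancelʳ false false true  _ = refl
xor-cancelʳ true  false true  ()
xor-cancelʳ false true  true  ()

module _ {r : ℕ} where

  act : Wreath r → Signed r → Signed r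
  act (v , σ) (s , k) = (s xor v (σ ⟨$⟩ʳ k) , σ ⟨$⟩ʳ k)

  act-cong : ∀ {x y} → x ≈W y → act x ≗ act y
  act-cong {v , σ} {w , τ} (v≗w , σ≗τ) (s , k) =
    cong₂ (λ b k′ → s xor b , k′) (trans (cong v (σ≗τ k)) (v≗w _)) (σ≗τ k)

  act-hom : ∀ x y → act (x ·W y) ≗ act x ∘ act y
  act-hom (v , σ) (w , τ) (s , k) = cong (_, σ ⟨$⟩ʳ (τ ⟨$⟩ʳ k)) (begin
    s xor (v (σ ⟨$⟩ʳ τk) xor w (σ ⟨$⟩ˡ (σ ⟨$⟩ʳ τk))) ≡⟨ cong (λ i → s xor (v (σ ⟨$⟩ʳ τk) xor w i)) (inverseˡ σ) ⟩
    s xor (v (σ ⟨$⟩ʳ τk) xor w τk)                  ≡⟨ cong (s xor_) (xor-comm (v _) (w τk)) ⟩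
    s xor (w τk xor v (σ ⟨$⟩ʳ τk))                  ≡⟨ sym (xor-assoc s (w τk) _) ⟩
    (s xor w τk) xor v (σ ⟨$⟩ʳ τk)                  ∎)
    where
      open ≡-Reasoning
      τk = τ ⟨$⟩ʳ k

  act-injective : ∀ x y → act x ≗ act y → x ≈W y
  act-injective (v , σ) (w , τ) act≗ = v≗w , σ≗τ
    where
      σ≗τ : ∀ k → σ ⟨$⟩ʳ k ≡ τ ⟨$⟩ʳ k
      σ≗τ k = cong position (act≗ (false , k))
      v≗w : v ≗ w
      v≗w i = begin
        v i                        ≡⟨ cong v (sym (inverseʳ σ)) ⟩
        v (σ ⟨$⟩ʳ (σ ⟨$⟩ˡ i))      ≡⟨ cong side (act≗ (false , σ ⟨$⟩ˡ i)) ⟩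
        w (τ ⟨$⟩ʳ (σ ⟨$⟩ˡ i))      ≡⟨ cong w (sym (σ≗τ (σ ⟨$⟩ˡ i))) ⟩
        w (σ ⟨$⟩ʳ (σ ⟨$⟩ˡ i))      ≡⟨ cong w (inverseʳ σ) ⟩
        w i                        ∎
        where open ≡-Reasoning

  act-isSigned : ∀ x → IsSigned (act x)
  act-isSigned (v , σ) = record
    { flip-commute = λ { (s , k) → cong (_, σ ⟨$⟩ʳ k) (sym (not-distribˡ-xor s _)) }
    ; injective    = λ { {s , k} {s′ , k′} e → pair-injective (cong side e) (σ-injective (cong position e)) }
    }
    where
      σ-injective : ∀ {k k′} → σ ⟨$⟩ʳ k ≡ σ ⟨$⟩ʳ k′ → k ≡ k′
      σ-injective e = trans (sym (inverseˡ σ)) (trans (cong (σ ⟨$⟩ˡ_) e) (inverseˡ σ))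
      pair-injective : ∀ {s s′ k k′} → s xor v (σ ⟨$⟩ʳ k) ≡ s′ xor v (σ ⟨$⟩ʳ k′) → k ≡ k′ → (s , k) ≡ (s′ , k′)
      pair-injective {s} {s′} {k} e refl = cong (_, k) (xor-cancelʳ s s′ (v (σ ⟨$⟩ʳ k)) e)

isZero : ∀ {r} → Fin r → Bool
isZero zero    = true
isZero (suc _) = false

adjacentTransposition : ∀ {m} → Fin m → Permutation′ (suc m)
adjacentTransposition q =
  permutation (swapAdjacent q) (swapAdjacent q) (swapAdjacent-involutive q) (swapAdjacent-involutive q)

generatorElement : ∀ {r} → Fin r → Wreath r
generatorElement zero    = isZero , Perm.id
generatorElement (suc q) = const false , adjacentTransposition q

wordElement : ∀ {r} → List (Fin r) → Wreath r
wordElement []      = const false , Perm.id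
wordElement (l ∷ w) = generatorElement l ·W wordElement w

module _ {r : ℕ} where

  act-generatorElement : ∀ (l : Fin r) → act (generatorElement l) ≗ gen l
  act-generatorElement zero    (true  , zero)  = refl
  act-generatorElement zero    (false , zero)  = refl
  act-generatorElement zero    (s     , suc k) = cong (_, suc k) (xor-identityʳ s)
  act-generatorElement (suc q) (s     , k)     = cong (_, swapAdjacent q k) (xor-identityʳ s)

  act-wordElement : ∀ (w : List (Fin r)) → act (wordElement w) ≗ eval w
  act-wordElement []      (s , k) = cong (_, k) (xor-identityʳ s)
  act-wordElement (l ∷ w) z = begin
    act (generatorElement l ·W wordElement w) z       ≡⟨ act-hom (generatorElement l) (wordElement w) z ⟩
    act (generatorElement l) (act (wordElement w) z)  ≡⟨ act-generatorElement l _ ⟩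
    gen l (act (wordElement w) z)                     ≡⟨ cong (gen l) (act-wordElement w z) ⟩
    gen l (eval w z)                                  ∎
    where open ≡-Reasoning

module _ {r n : ℕ} where

  ρ-cons-cong : ∀ (e : Edge r n) {E F} l x → ρ E l x ≡ ρ F l x → ρ (e ∷ E) l x ≡ ρ (e ∷ F) l x
  ρ-cons-cong (l′ , u , v) l x E≡F with l′ ≟ l | x ≟ u | x ≟ v
  ... | yes _ | yes _ | _     = refl
  ... | yes _ | no  _ | yes _ = refl
  ... | yes _ | no  _ | no  _ = E≡F
  ... | no  _ | _     | _     = E≡F

  ρ-cons-other : ∀ {l′ l u v x} {E : List (Edge r n)} → l′ ≢ l → ρ ((l′ , u , v) ∷ E) l x ≡ ρ E l x
  ρ-cons-other {l′} {l} l′≢l with l′ ≟ l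
  ... | yes l′≡l = contradiction l′≡l l′≢l
  ... | no  _    = refl

  ρ-filter : ∀ (E : List (Edge r n)) l x → ρ E l x ≡ ρ (filter (λ e → label e ≟ l) E) l x
  ρ-filter []      l x = refl
  ρ-filter (e ∷ E) l x = by-cases (label e ≟ l)
    where
      open ≡-Reasoning
      filtered = filter (λ e → label e ≟ l)
      by-cases : Dec (label e ≡ l) → ρ (e ∷ E) l x ≡ ρ (filtered (e ∷ E)) l x
      by-cases (yes e∈l) = begin
        ρ (e ∷ E) l x            ≡⟨ ρ-cons-cong e l x (ρ-filter E l x) ⟩
        ρ (e ∷ filtered E) l x   ≡⟨ cong (λ F → ρ F l x) (filter-accept (λ e → label e ≟ l) e∈l) ⟨
        ρ (filtered (e ∷ E)) l x ∎
      by-cases (no e∉l) = begin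
        ρ (e ∷ E) l x            ≡⟨ ρ-cons-other e∉l ⟩
        ρ E l x                  ≡⟨ ρ-filter E l x ⟩
        ρ (filtered E) l x       ≡⟨ cong (λ F → ρ F l x) (filter-reject (λ e → label e ≟ l) e∉l) ⟨
        ρ (filtered (e ∷ E)) l x ∎

  ρ-edge-src : ∀ l u v (E : List (Edge r n)) → ρ ((l , u , v) ∷ E) l u ≡ v
  ρ-edge-src l u v E with l ≟ l | u ≟ u
  ... | yes _  | yes _   = refl
  ... | yes _  | no u≢u  = contradiction refl u≢u
  ... | no l≢l | _       = contradiction refl l≢l

  ρ-edge-tgt : ∀ l u v (E : List (Edge r n)) → u ≢ v → ρ ((l , u , v) ∷ E) l v ≡ u
  ρ-edge-tgt l u v E u≢v with l ≟ l | v ≟ u | v ≟ v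
  ... | yes _  | yes v≡u | _      = contradiction (sym v≡u) u≢v
  ... | yes _  | no _    | yes _  = refl
  ... | yes _  | no _    | no v≢v = contradiction refl v≢v
  ... | no l≢l | _       | _      = contradiction refl l≢l

  ρ-edge-miss : ∀ l u v (E : List (Edge r n)) {x} → x ≢ u → x ≢ v → ρ ((l , u , v) ∷ E) l x ≡ ρ E l x
  ρ-edge-miss l u v E {x} x≢u x≢v with l ≟ l | x ≟ u | x ≟ v
  ... | yes _ | yes x≡u | _       = contradiction x≡u x≢u
  ... | yes _ | no _    | yes x≡v = contradiction x≡v x≢v
  ... | yes _ | no _    | no _    = refl
  ... | no _  | _       | _       = refl

module _ {a p} {A : Set a} {P : Pred A p} (P? : Decidable P) where

  filter-concat-tabulate-none : ∀ {k} (f : Fin k → List A) → (∀ i → filter P? (f i) ≡ []) →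
                                filter P? (concat (tabulate f)) ≡ []
  filter-concat-tabulate-none {zero}  f none = refl
  filter-concat-tabulate-none {suc k} f none =
    trans (filter-++ P? (f zero) _) (cong₂ _++_ (none zero) (filter-concat-tabulate-none (f ∘ suc) (none ∘ suc)))

  filter-concat-tabulate-single : ∀ {k} (f : Fin k → List A) i → (∀ j → j ≢ i → filter P? (f j) ≡ []) →
                                  filter P? (concat (tabulate f)) ≡ filter P? (f i)
  filter-concat-tabulate-single f zero    others = begin
    filter P? (f zero ++ concat (tabulate (f ∘ suc)))               ≡⟨ filter-++ P? (f zero) _ ⟩
    filter P? (f zero) ++ filter P? (concat (tabulate (f ∘ suc)))   ≡⟨ cong (filter P? (f zero) ++_)
                                                                         (filter-concat-tabulate-none (f ∘ suc) (λ j → others (suc j) λ ())) ⟩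
    filter P? (f zero) ++ []                                         ≡⟨ ++-identityʳ _ ⟩
    filter P? (f zero)                                               ∎
    where open ≡-Reasoning
  filter-concat-tabulate-single f (suc i) others =
    trans (filter-++ P? (f zero) _)
          (cong₂ _++_ (others zero λ ())
                      (filter-concat-tabulate-single (f ∘ suc) i (λ j j≢i → others (suc j) (j≢i ∘ suc-injective))))

concatMap-toList-tabulate : ∀ {a b} {A : Set a} {B : Set b} {k} (f : A → List B) (g : Fin k → A) →
                            concatMap f (Vec.toList (Vec.tabulate g)) ≡ concat (tabulate (f ∘ g))
concatMap-toList-tabulate {k = zero}  f g = refl
concatMap-toList-tabulate {k = suc k} f g = cong (f (g zero) ++_) (concatMap-toList-tabulate f (g ∘ suc))

AllPairs-lookup : ∀ {a ℓ} {A : Set a} {R : Rel A ℓ} → Symmetric R → ∀ {xs} → AllPairs R xs →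
                  ∀ {p q} → p ≢ q → R (lookup xs p) (lookup xs q)
AllPairs-lookup sym-R (x∼xs ∷ _)   {zero}  {zero}  0≢0   = contradiction refl 0≢0
AllPairs-lookup sym-R (x∼xs ∷ _)   {zero}  {suc q} _     = All.lookup x∼xs (∈-lookup q)
AllPairs-lookup sym-R (x∼xs ∷ _)   {suc p} {zero}  _     = sym-R (All.lookup x∼xs (∈-lookup p))
AllPairs-lookup sym-R (_ ∷ ∼xs)    {suc p} {suc q} p≢q   = AllPairs-lookup sym-R ∼xs (p≢q ∘ cong suc)

SameLabelDisjoint : ∀ {r n} → Rel (Edge r n) _
SameLabelDisjoint e e′ = label e ≡ label e′ → ∀ x → OnEdge x e → ¬ OnEdge x e′

sameLabelDisjoint-sym : ∀ {r n} → Symmetric (SameLabelDisjoint {r} {n})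
sameLabelDisjoint-sym disjoint e′≡e x x∈e′ x∈e = disjoint (sym e′≡e) x x∈e x∈e′

module _ {r n : ℕ} {ρ′ : Fin r → Fin n → Fin n} where

  ∈⟨⟩-resp-≗ : ∀ {I f g} → f ≗ g → f ∈⟨ I ⟩[ ρ′ ] → g ∈⟨ I ⟩[ ρ′ ]
  ∈⟨⟩-resp-≗ f≗g (w , w∈I , w≗f) = w , w∈I , λ x → trans (w≗f x) (f≗g x)

  ∈⟨⟩-mono : ∀ {I J g} → I ⊆ J → g ∈⟨ I ⟩[ ρ′ ] → g ∈⟨ J ⟩[ ρ′ ]
  ∈⟨⟩-mono I⊆J (w , w∈I , w≗g) = w , All.map I⊆J w∈I , w≗g

module _ {m : ℕ} where

  private
    R = suc m
    E = pathGraph R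

  encode : Signed R → Fin (R + R)
  encode (false , k) = vA k
  encode (true  , k) = vB k

  decode : Fin (R + R) → Signed R
  decode x = [ (false ,_) , (true ,_) ]′ (splitAt R x)

  encode-decode : ∀ x → encode (decode x) ≡ x
  encode-decode x = trans (encode-sum (splitAt R x)) (join-splitAt R R x)
    where
      encode-sum : ∀ s → encode ([ (false ,_) , (true ,_) ]′ s) ≡ join R R s
      encode-sum (inj₁ k) = refl
      encode-sum (inj₂ k) = refl

  decode-encode : ∀ z → decode (encode z) ≡ z
  decode-encode (false , k) = cong [ (false ,_) , (true ,_) ]′ (splitAt-join R R (inj₁ k))
  decode-encode (true  , k) = cong [ (false ,_) , (true ,_) ]′ (splitAt-join R R (inj₂ k))

  encode-injective : ∀ {z z′} → encode z ≡ encode z′ → z ≡ z′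
  encode-injective {z} {z′} e = trans (sym (decode-encode z)) (trans (cong decode e) (decode-encode z′))

  encode-≢ : ∀ z z′ → z ≢ z′ → encode z ≢ encode z′
  encode-≢ z z′ z≢z′ = z≢z′ ∘ encode-injective {z} {z′}

  vA≢vB : ∀ (k k′ : Fin R) → vA k ≢ vB k′
  vA≢vB k k′ = encode-≢ (false , k) (true , k′) λ ()

  encode-position-≢ : ∀ s {k k′ : Fin R} → k ≢ k′ → encode (s , k) ≢ encode (s , k′)
  encode-position-≢ s {k} {k′} k≢k′ = encode-≢ (s , k) (s , k′) (k≢k′ ∘ cong position)

  edgesOfLabel-labels : ∀ (l : Fin R) → All (λ e → label e ≡ l) (edgesOfLabel l)
  edgesOfLabel-labels zero    = refl ∷ []
  edgesOfLabel-labels (suc q) = refl ∷ refl ∷ []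

  pathGraph-tabulate : pathGraph R ≡ concat (tabulate edgesOfLabel)
  pathGraph-tabulate = concatMap-toList-tabulate edgesOfLabel (λ l → l)

  pathGraph-filter : ∀ l → filter (λ e → label e ≟ l) (pathGraph R) ≡ edgesOfLabel l
  pathGraph-filter l = begin
    filter l? (pathGraph R)                    ≡⟨ cong (filter l?) pathGraph-tabulate ⟩
    filter l? (concat (tabulate edgesOfLabel)) ≡⟨ filter-concat-tabulate-single l? edgesOfLabel l other-labels ⟩
    filter l? (edgesOfLabel l)                 ≡⟨ filter-all l? (edgesOfLabel-labels l) ⟩
    edgesOfLabel l                             ∎
    where
      open ≡-Reasoning
      l? = λ (e : Edge R (R + R)) → label e ≟ l
      other-labels : ∀ j → j ≢ l → filter l? (edgesOfLabel j) ≡ []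
      other-labels j j≢l = filter-none l? (All.map (λ e∈j e∈l → j≢l (trans (sym e∈j) e∈l)) (edgesOfLabel-labels j))

  ρ-adjacentEdge : ∀ s (q : Fin m) k l (E : List (Edge R (R + R))) → ρ E l (encode (s , k)) ≡ encode (s , k) →
                   ρ ((l , encode (s , inject₁ q) , encode (s , suc q)) ∷ E) l (encode (s , k)) ≡ encode (s , swapAdjacent q k)
  ρ-adjacentEdge s q k l E E-fixes with k ≟ inject₁ q | k ≟ suc q
  ... | yes refl | _        = trans (ρ-edge-src l _ _ E) (cong (encode ∘ (s ,_)) (sym (swapAdjacent-inject₁ q)))
  ... | no _     | yes refl = trans (ρ-edge-tgt l _ _ E (encode-position-≢ s (inject₁≢suc q)))
                                    (cong (encode ∘ (s ,_)) (sym (swapAdjacent-suc q)))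
  ... | no k≢q   | no k≢q+1 = trans (ρ-edge-miss l _ _ E (encode-position-≢ s k≢q) (encode-position-≢ s k≢q+1))
                                    (trans E-fixes (cong (encode ∘ (s ,_)) (sym (swapAdjacent-fixes-other q k≢q k≢q+1))))

  ρ-edgesOfLabel : ∀ (l : Fin R) z → ρ (edgesOfLabel l) l (encode z) ≡ encode (gen l z)
  ρ-edgesOfLabel zero    (false , zero)  = ρ-edge-src {R} zero (vA zero) (vB zero) []
  ρ-edgesOfLabel zero    (true  , zero)  = ρ-edge-tgt {R} zero (vA zero) (vB zero) [] (vA≢vB zero zero)
  ρ-edgesOfLabel zero    (s     , suc k) =
    ρ-edge-miss {R} zero (vA zero) (vB zero) []
      (encode-≢ (s , suc k) (false , zero) λ ()) (encode-≢ (s , suc k) (true , zero) λ ())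
  ρ-edgesOfLabel (suc q) (false , k)     =
    ρ-adjacentEdge false q k (suc q) _ (ρ-edge-miss (suc q) _ _ [] (vA≢vB k (inject₁ q)) (vA≢vB k (suc q)))
  ρ-edgesOfLabel (suc q) (true  , k)     =
    trans (ρ-edge-miss (suc q) _ _ _ (vA≢vB (inject₁ q) k ∘ sym) (vA≢vB (suc q) k ∘ sym))
          (ρ-adjacentEdge true q k (suc q) [] refl)

  ρ-pathGraph : ∀ l z → ρ (pathGraph R) l (encode z) ≡ encode (gen l z)
  ρ-pathGraph l z = begin
    ρ (pathGraph R) l (encode z)                                     ≡⟨ ρ-filter (pathGraph R) l _ ⟩
    ρ (filter (λ e → label e ≟ l) (pathGraph R)) l (encode z)        ≡⟨ cong (λ E → ρ E l (encode z)) (pathGraph-filter l) ⟩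
    ρ (edgesOfLabel l) l (encode z)                                  ≡⟨ ρ-edgesOfLabel l z ⟩
    encode (gen l z)                                                 ∎
    where open ≡-Reasoning

  edgesOfLabel-noLoops : ∀ (l : Fin R) → All (λ { (_ , u , v) → u ≢ v }) (edgesOfLabel l)
  edgesOfLabel-noLoops zero    = vA≢vB zero zero ∷ []
  edgesOfLabel-noLoops (suc q) = encode-position-≢ false (inject₁≢suc q) ∷ encode-position-≢ true (inject₁≢suc q) ∷ []

  edgesOfLabel-disjoint : ∀ (l : Fin R) → AllPairs SameLabelDisjoint (edgesOfLabel l)
  edgesOfLabel-disjoint zero    = [] ∷ []
  edgesOfLabel-disjoint (suc q) = (disjoint ∷ []) ∷ [] ∷ []
    where
      disjoint : SameLabelDisjoint (suc q , vA (inject₁ q) , vA (suc q)) (suc q , vB (inject₁ q) , vB (suc q))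
      disjoint _ x (inj₁ refl) (inj₁ x≡v) = vA≢vB _ _ x≡v
      disjoint _ x (inj₁ refl) (inj₂ x≡v) = vA≢vB _ _ x≡v
      disjoint _ x (inj₂ refl) (inj₁ x≡v) = vA≢vB _ _ x≡v
      disjoint _ x (inj₂ refl) (inj₂ x≡v) = vA≢vB _ _ x≡v

  edgesOfLabel-labelsDiffer : ∀ {i j : Fin R} → i ≢ j →
                              All (λ e → All (SameLabelDisjoint e) (edgesOfLabel j)) (edgesOfLabel i)
  edgesOfLabel-labelsDiffer {i} {j} i≢j =
    All.map (λ e∈i → All.map (λ e′∈j e≡e′ → contradiction (trans (sym e∈i) (trans e≡e′ e′∈j)) i≢j)
                             (edgesOfLabel-labels j))
            (edgesOfLabel-labels i)

  pathGraph-isLabelledGraph : IsLabelledGraph E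
  pathGraph-isLabelledGraph = record
    { noLoops     = subst (All _) (sym pathGraph-tabulate) (All.concat⁺ (All.tabulate⁺ edgesOfLabel-noLoops))
    ; atMostOne   = λ p q p≢q → AllPairs-lookup sameLabelDisjoint-sym disjoint p≢q
    ; labelsOccur = λ l → subst (Any _) (sym pathGraph-tabulate)
                                (Any.concat⁺ (Any.tabulate⁺ {f = edgesOfLabel} l (first-edge l)))
    }
    where
      disjoint : AllPairs SameLabelDisjoint E
      disjoint = subst (AllPairs _) (sym pathGraph-tabulate)
        (AllPairs.concat⁺ (All.tabulate⁺ edgesOfLabel-disjoint) (AllPairs.tabulate⁺ edgesOfLabel-labelsDiffer))
      first-edge : ∀ l → Any (λ e → label e ≡ l) (edgesOfLabel l)
      first-edge zero    = here refl
      first-edge (suc q) = here refl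

  evalWord-pathGraph : ∀ w x → evalWord (ρ E) w x ≡ encode (eval w (decode x))
  evalWord-pathGraph []      x = sym (encode-decode x)
  evalWord-pathGraph (l ∷ w) x = begin
    ρ E l (evalWord (ρ E) w x)               ≡⟨ cong (ρ E l) (evalWord-pathGraph w x) ⟩
    ρ E l (encode (eval w (decode x)))       ≡⟨ ρ-pathGraph l _ ⟩
    encode (gen l (eval w (decode x)))       ∎
    where open ≡-Reasoning

  evalWord-trivial : ∀ w → (∀ z → eval w z ≡ z) → evalWord (ρ E) w ≗ id
  evalWord-trivial w w≗id x = trans (evalWord-pathGraph w x) (trans (cong encode (w≗id (decode x))) (encode-decode x))

  ∈⟨⟩⇒∈⟪⟫ : ∀ {I g} → g ∈⟨ I ⟩[ ρ E ] → decode ∘ g ∘ encode ∈⟪ I ⟫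
  ∈⟨⟩⇒∈⟪⟫ {g = g} (w , w∈I , w≗g) = w , w∈I , λ z → begin
    eval w z                                    ≡⟨ decode-encode _ ⟨
    decode (encode (eval w z))                  ≡⟨ cong (decode ∘ encode ∘ eval w) (decode-encode z) ⟨
    decode (encode (eval w (decode (encode z)))) ≡⟨ cong decode (evalWord-pathGraph w (encode z)) ⟨
    decode (evalWord (ρ E) w (encode z))        ≡⟨ cong decode (w≗g (encode z)) ⟩
    decode (g (encode z))                       ∎
    where open ≡-Reasoning

  ∈⟪⟫⇒∈⟨⟩ : ∀ {I h} → h ∈⟪ I ⟫ → (encode ∘ h ∘ decode) ∈⟨ I ⟩[ ρ E ]
  ∈⟪⟫⇒∈⟨⟩ (w , w∈I , w≗h) = w , w∈I , λ x → trans (evalWord-pathGraph w x) (cong encode (w≗h (decode x)))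

  ∈⟨⟩-∩ : ∀ {I J g} → g ∈⟨ I ⟩[ ρ E ] → g ∈⟨ J ⟩[ ρ E ] → g ∈⟨ I ∩ J ⟩[ ρ E ]
  ∈⟨⟩-∩ {g = g} g∈I g∈J = ∈⟨⟩-resp-≗ (λ x → trans (encode-decode _) (cong g (encode-decode x)))
                              (∈⟪⟫⇒∈⟨⟩ (∈⟪⟫-∩ (∈⟨⟩⇒∈⟪⟫ g∈I) (∈⟨⟩⇒∈⟪⟫ g∈J)))

  pathGraph-isStringCGroup : IsStringCGroup (ρ E)
  pathGraph-isStringCGroup = record
    { involution    = λ i → evalWord-trivial (i ∷ i ∷ []) (gen-involutive i)
    ; nontrivial    = nontrivial
    ; stringCommute = λ i j far → evalWord-trivial (i ∷ j ∷ i ∷ j ∷ []) (gen-farApart-squared i j far)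
    ; intersection  = λ I J g → (λ (g∈I , g∈J) → ∈⟨⟩-∩ g∈I g∈J) ,
                                λ g∈I∩J → ∈⟨⟩-mono (p∩q⊆p I J) g∈I∩J , ∈⟨⟩-mono (p∩q⊆q I J) g∈I∩J
    }
    where
      nontrivial : ∀ i → ¬ (ρ E i ≗ id)
      nontrivial i ρᵢ≗id = let z , moves = gen-moves i in
        moves (encode-injective (trans (sym (ρ-pathGraph i z)) (ρᵢ≗id (encode z))))

  pathGraph-wreathIso : WreathIso (ρ E)
  pathGraph-wreathIso = record
    { φ         = φ
    ; wellDef   = λ x y x≈y → cong encode ∘ act-cong {x = x} {y} x≈y ∘ decode
    ; hom       = λ x y z → cong encode
                    (trans (act-hom x y (decode z)) (cong (act x) (sym (decode-encode (act y (decode z))))))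
    ; injective = λ x y φx≗φy → act-injective x y λ z → encode-injective (begin
        encode (act x z)                   ≡⟨ cong (encode ∘ act x) (decode-encode z) ⟨
        φ x (encode z)                     ≡⟨ φx≗φy (encode z) ⟩
        encode (act y (decode (encode z))) ≡⟨ cong (encode ∘ act y) (decode-encode z) ⟩
        encode (act y z)                   ∎)
    ; intoG     = λ x → ∈⟪⟫⇒∈⟨⟩ (generate (act-isSigned x) (λ l∉⊤ → contradiction ∈⊤ l∉⊤))
    ; ontoG     = λ g (w , _ , w≗g) → wordElement w , λ x →
        trans (cong encode (act-wordElement w (decode x))) (trans (sym (evalWord-pathGraph w x)) (w≗g x))
    }
    where
      open ≡-Reasoning
      φ : Wreath R → Fin (R + R) → Fin (R + R)
      φ x = encode ∘ act x ∘ decode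

-- The hypothesis 2 ≤ r only excludes r = 0: the argument works for every r ≥ 1.
lemma4p5 : (r : ℕ) → 2 ≤ r →
    IsCPRGraph (pathGraph r) × WreathIso (ρ (pathGraph r))
lemma4p5 (suc m) _ = (pathGraph-isLabelledGraph , pathGraph-isStringCGroup) , pathGraph-wreathIso
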